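{- Let $\mathsf P$ be a piece with basic move set $\mathcal M$, $\mathcal B$ a rational convex polygon, and $q\ge 1$. The number of unlabelled combinatorial types of nonattacking configuration of $q$ pieces is $1$ if $|\mathcal M|=1$, and is $q!$ if $|\mathcal M|=2$.
   Context: $\mathcal M$ is a nonempty finite set of nonzero vectors $m_r=(c_r,d_r)\in\mathbb Z^2$ with $\gcd(c_r,d_r)=1$, no two parallel; $m_r^\perp=(d_r,-c_r)$. $\mathcal B\subset\mathbb R^2$ is a closed two-dimensional convex polygon with rational vertices and interior $\mathcal B^\circ$. For a positive integer $t$, a labelled configuration is $\mathbf z=(z_1,\dots,z_q)$, $z_i\in t\mathcal B^\circ\cap\mathbb Z^2$, nonattacking if $(z_j-z_i)\cdot m_r^\perp\ne 0$ for all $i\ne j$ and all $r$. Its labelled type is the family of sets $L_{ir}=\{j:(z_j-z_i)\cdot m_r^\perp>0\}$, $i=1,\dots,q$, $m_r\in\mathcal M$, taken over nonattacking configurations for all $t$; unlabelled combinatorial types are obtained by forgetting labels (orbits under permutation of the pieces). -}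

module Defs where

open import Data.Nat as ℕ using (ℕ; suc)
open import Data.Integer as ℤ using (ℤ; +_; 0ℤ; 1ℤ)
import Data.Integer.Properties as ℤP
open import Data.Integer.GCD using (gcd)
open import Data.Rational as ℚ using (ℚ)
open import Data.Fin using (Fin)
open import Data.Fin.Permutation using (Permutation′; _⟨$⟩ʳ_)
open import Data.Product using (_×_; _,_; Σ; ∃; proj₁; proj₂)
open import Data.Bool using (Bool)
open import Relation.Nullary using (¬_)
open import Relation.Nullary.Decidable using (⌊_⌋)
open import Relation.Binary.PropositionalEquality using (_≡_; _≢_)

Vec2 : Set
Vec2 = ℤ × ℤ

_-v_ : Vec2 → Vec2 → Vec2
(a , b) -v (c , d) = (a ℤ.- c , b ℤ.- d)

_·_ : Vec2 → Vec2 → ℤ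
(a , b) · (c , d) = a ℤ.* c ℤ.+ b ℤ.* d

perp : Vec2 → Vec2
perp (c , d) = (d , ℤ.- c)

-- Each move is nonzero and primitive (gcd 1); distinct indices give nonparallel moves
-- (so in particular the k moves are distinct and |M| = k).
ValidMoves : (k : ℕ) → (Fin k → Vec2) → Set
ValidMoves k m =
  ((r : Fin k) → m r ≢ (0ℤ , 0ℤ))
  × ((r : Fin k) → gcd (proj₁ (m r)) (proj₂ (m r)) ≡ 1ℤ)
  × ((r s : Fin k) → r ≢ s →
       proj₁ (m r) ℤ.* proj₂ (m s) ℤ.- proj₂ (m r) ℤ.* proj₁ (m s) ≢ 0ℤ)

-- A rational convex polygon in H-representation:
--   B = { (x , y) ∈ ℝ² : a_l x + b_l y ≤ c_l  for all l < n }
-- with a_l, b_l, c_l rational and every normal (a_l , b_l) nonzero.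
record Polygon : Set where
  field
    n     : ℕ
    a b c : Fin n → ℚ

open Polygon public

InB : Polygon → ℚ → ℚ → Set
InB B x y = (l : Fin (n B)) → a B l ℚ.* x ℚ.+ b B l ℚ.* y ℚ.≤ c B l

InB° : Polygon → ℚ → ℚ → Set
InB° B x y = (l : Fin (n B)) → a B l ℚ.* x ℚ.+ b B l ℚ.* y ℚ.< c B l

ValidPolygon : Polygon → Set
ValidPolygon B =
  ((l : Fin (n B)) → ¬ (a B l ≡ ℚ.0ℚ × b B l ≡ ℚ.0ℚ))
  × ∃ (λ x → ∃ λ y → InB° B x y)
  × ∃ (λ R → (x y : ℚ) → InB B x y → (ℚ.∣ x ∣ ℚ.≤ R) × (ℚ.∣ y ∣ ℚ.≤ R))

ι : ℤ → ℚ
ι z = z ℚ./ 1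

-- z ∈ t B° ∩ ℤ²   (t B° = { p : p / t ∈ B° } = strict constraints scaled by t)
InTB° : Polygon → ℕ → Vec2 → Set
InTB° B t (x , y) =
  (l : Fin (n B)) → a B l ℚ.* ι x ℚ.+ b B l ℚ.* ι y ℚ.< ι (+ t) ℚ.* c B l

Config : ℕ → Set
Config q = Fin q → Vec2

Nonattacking : (k : ℕ) → (Fin k → Vec2) → (q : ℕ) → Config q → Set
Nonattacking k m q z =
  (i j : Fin q) → i ≢ j → (r : Fin k) → (z j -v z i) · perp (m r) ≢ 0ℤ

-- A labelled type: for each piece i and move r, the set L_{ir} ⊆ {1..q},
-- encoded by its characteristic function.
LType : ℕ → ℕ → Set
LType k q = Fin q → Fin k → Fin q → Bool

typeOf : (k : ℕ) → (Fin k → Vec2) → (q : ℕ) → Config q → LType k q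
typeOf k m q z i r j = ⌊ 0ℤ ℤP.<? ((z j -v z i) · perp (m r)) ⌋

IsLabelledType : (k : ℕ) → (Fin k → Vec2) → Polygon → (q : ℕ) → LType k q → Set
IsLabelledType k m B q T =
  Σ ℕ λ t → Σ (Config q) λ z →
    (1 ℕ.≤ t) × ((i : Fin q) → InTB° B t (z i)) × Nonattacking k m q z
    × ((i : Fin q) (r : Fin k) (j : Fin q) → T i r j ≡ typeOf k m q z i r j)

SameOrbit : (k q : ℕ) → LType k q → LType k q → Set
SameOrbit k q T T′ =
  Σ (Permutation′ q) λ σ →
    (i : Fin q) (r : Fin k) (j : Fin q) → T′ (σ ⟨$⟩ʳ i) r (σ ⟨$⟩ʳ j) ≡ T i r j

NumUnlabelledTypes : (k : ℕ) → (Fin k → Vec2) → Polygon → (q : ℕ) → ℕ → Set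
NumUnlabelledTypes k m B q N =
  Σ (Fin N → LType k q) λ rep →
    ((u : Fin N) → IsLabelledType k m B q (rep u))
    × ((u v : Fin N) → SameOrbit k q (rep u) (rep v) → u ≡ v)
    × ((T : LType k q) → IsLabelledType k m B q T → ∃ λ u → SameOrbit k q (rep u) T)

module Submission where

-- For a configuration z and a move m_r, the sets L_{ir} record exactly the
-- strict order of the integers z_i · m_r^⊥, which are pairwise distinct since
-- z is nonattacking.  Replacing this order by its rank permutation π_r shows
-- that every labelled type is  permType π  for a k-tuple π of permutations of
-- the pieces, and relabelling by σ acts on π by precomposition with σ.  Since
-- a permutation is determined by the order pattern of its ranks, two tuples
-- give types in the same orbit exactly when they differ by such a σ.
-- Conversely every tuple is realised when k ≤ 2: there are lattice vectors
-- w_i with w_i · m_r^⊥ = (rank of i in π_r) · s for a fixed s > 0 (using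
-- u^⊥ for one move, the determinant of the two moves for two), and a translate
-- of w lies in t B° once t is a large multiple of the denominators of an
-- interior point (Archimedes).
--
-- So the unlabelled types are the orbits of k-tuples of permutations under
-- simultaneous precomposition: a single orbit when k = 1, and for k = 2 the
-- orbits are represented exactly once by the pairs (id , π), with π running
-- through an explicit enumeration of the q! permutations.

open import Defs
open import Data.Nat as ℕ using (ℕ; _≤_; _!; zero; suc)
import Data.Nat.Properties as ℕP
open import Data.Nat.Tactic.RingSolver as ℕSolver using ()
open import Data.Integer as ℤ using (ℤ; +_; -[1+_]; +[1+_]; 0ℤ; +0)
import Data.Integer.Properties as ℤP
open import Data.Integer.Tactic.RingSolver as ℤSolver using ()
open import Data.Rational as ℚ using (ℚ; mkℚ; 0ℚ)
import Data.Rational.Properties as ℚP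
import Data.Rational.Solver
open import Data.Rational.Unnormalised as U using (mkℚᵘ; *≡*; *<*)
import Data.Rational.Unnormalised.Properties as UP
open import Data.Fin as F using (Fin; zero; suc; toℕ; punchIn; punchOut)
import Data.Fin.Properties as FP
open import Data.Fin.Permutation as P using (Permutation′; _⟨$⟩ʳ_; _⟨$⟩ˡ_)
open import Data.Product using (_×_; Σ; ∃; _,_; proj₁; proj₂)
open import Data.Bool using (Bool)
open import Data.Empty using (⊥-elim)
open import Function using (_∘_; _⇔_; mk⇔; Injective)
open import Function.Bundles using (Equivalence)
import Function.Properties.Equivalence as ⇔
open import Relation.Nullary using (Dec; yes; no)
open import Relation.Nullary.Decidable using (⌊_⌋; isYes≗does; does-⇔)
open import Relation.Binary.PropositionalEquality
  using (_≡_; _≢_; refl; sym; trans; cong; cong₂; subst; subst₂; module ≡-Reasoning)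
open import Relation.Binary.Definitions using (tri<; tri≈; tri>)

open Equivalence using (to; from)

isYes-⇔ : {A B : Set} (a? : Dec A) (b? : Dec B) → A ⇔ B → ⌊ a? ⌋ ≡ ⌊ b? ⌋
isYes-⇔ a? b? A⇔B =
  trans (isYes≗does a?) (trans (does-⇔ A⇔B a? b?) (sym (isYes≗does b?)))

isYes-≡⇒⇔ : {A B : Set} (a? : Dec A) (b? : Dec B) → ⌊ a? ⌋ ≡ ⌊ b? ⌋ → A ⇔ B
isYes-≡⇒⇔ (yes a) (yes b) _ = mk⇔ (λ _ → b) (λ _ → a)
isYes-≡⇒⇔ (no ¬a) (no ¬b) _ = mk⇔ (⊥-elim ∘ ¬a) (⊥-elim ∘ ¬b)
isYes-≡⇒⇔ (yes _) (no _) ()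
isYes-≡⇒⇔ (no _) (yes _) ()

⇔-resp-< : {A : Set} {x x′ y y′ : ℤ} → x′ ≡ x → y′ ≡ y → A ⇔ (x ℤ.< y) → A ⇔ (x′ ℤ.< y′)
⇔-resp-< refl refl A⇔x<y = A⇔x<y

-- Order patterns of integer sequences

order : {q : ℕ} → (Fin q → ℤ) → Fin q → Fin q → Bool
order g i j = ⌊ g i ℤP.<? g j ⌋

SameOrder : {q : ℕ} → (Fin q → ℤ) → (Fin q → ℤ) → Set
SameOrder g h = ∀ i j → (g i ℤ.< g j) ⇔ (h i ℤ.< h j)

sameOrder⇒order≡ : {q : ℕ} {g h : Fin q → ℤ} → SameOrder g h →
                   ∀ i j → order g i j ≡ order h i j
sameOrder⇒order≡ {g = g} {h} same i j = isYes-⇔ (g i ℤP.<? g j) (h i ℤP.<? h j) (same i j)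

order≡⇒sameOrder : {q : ℕ} {g h : Fin q → ℤ} →
                   (∀ i j → order g i j ≡ order h i j) → SameOrder g h
order≡⇒sameOrder {g = g} {h} eq i j = isYes-≡⇒⇔ (g i ℤP.<? g j) (h i ℤP.<? h j) (eq i j)

sameOrder-scale : {q : ℕ} (g : Fin q → ℤ) (s : ℕ) →
                  SameOrder (λ i → g i ℤ.* +[1+ s ]) g
sameOrder-scale g s i j =
  mk⇔ (ℤP.*-cancelʳ-<-nonNeg +[1+ s ]) (ℤP.*-monoʳ-<-pos +[1+ s ])

sameOrder-injective : {q : ℕ} {g h : Fin q → ℤ} → SameOrder g h →
                      Injective _≡_ _≡_ h → Injective _≡_ _≡_ g
sameOrder-injective {g = g} {h} same h-inj {i} {j} gi≡gj with ℤP.<-cmp (h i) (h j)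
... | tri< hi<hj _ _ = ⊥-elim (ℤP.<-irrefl gi≡gj (from (same i j) hi<hj))
... | tri≈ _ hi≡hj _ = h-inj hi≡hj
... | tri> _ _ hj<hi = ⊥-elim (ℤP.<-irrefl (sym gi≡gj) (from (same j i) hj<hi))

ranks : {q : ℕ} → Permutation′ q → Fin q → ℤ
ranks ρ i = + toℕ (ρ ⟨$⟩ʳ i)

ranks-<⇔ : {q : ℕ} (ρ : Permutation′ q) (i j : Fin q) →
           (ρ ⟨$⟩ʳ i F.< ρ ⟨$⟩ʳ j) ⇔ (ranks ρ i ℤ.< ranks ρ j)
ranks-<⇔ ρ i j = mk⇔ ℤ.+<+ ℤP.drop‿+<+

ranks-injective : {q : ℕ} (ρ : Permutation′ q) → Injective _≡_ _≡_ (ranks ρ)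
ranks-injective ρ {i} {j} eq = begin
  i                       ≡⟨ P.inverseˡ ρ ⟨
  ρ ⟨$⟩ˡ (ρ ⟨$⟩ʳ i)       ≡⟨ cong (ρ ⟨$⟩ˡ_) (FP.toℕ-injective (ℤP.+-injective eq)) ⟩
  ρ ⟨$⟩ˡ (ρ ⟨$⟩ʳ j)       ≡⟨ P.inverseˡ ρ ⟩
  j                       ∎
  where open ≡-Reasoning

increasing⇒inflationary : {q : ℕ} (f : Fin q → Fin q) →
                          (∀ {i j} → i F.< j → f i F.< f j) → ∀ i → i F.≤ f i
increasing⇒inflationary {q} f increasing i = atLeast (toℕ i) i refl
  where
  atLeast : ∀ k (i : Fin q) → toℕ i ≡ k → k ℕ.≤ toℕ (f i)
  atLeast zero    _ _ = ℕ.z≤n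
  atLeast (suc k) i i≡1+k = ℕP.≤-<-trans (atLeast k i′ (FP.toℕ-fromℕ< k<q)) (increasing i′<i)
    where
    k<q : k ℕ.< q
    k<q = ℕP.<-trans (ℕP.n<1+n k) (subst (ℕ._< q) i≡1+k (FP.toℕ<n i))
    i′ : Fin q
    i′ = F.fromℕ< k<q
    i′<i : i′ F.< i
    i′<i = subst₂ ℕ._<_ (sym (FP.toℕ-fromℕ< k<q)) (sym i≡1+k) (ℕP.n<1+n k)

-- A permutation that preserves and reflects the order of Fin q is the identity:
-- it and its inverse are both inflationary.
orderIso⇒id : {q : ℕ} (σ : Permutation′ q) →
              (∀ i j → (i F.< j) ⇔ (σ ⟨$⟩ʳ i F.< σ ⟨$⟩ʳ j)) → ∀ i → σ ⟨$⟩ʳ i ≡ i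
orderIso⇒id σ iso i = FP.toℕ-injective (ℕP.≤-antisym σi≤i i≤σi)
  where
  i≤σi : i F.≤ σ ⟨$⟩ʳ i
  i≤σi = increasing⇒inflationary (σ ⟨$⟩ʳ_) (to (iso _ _)) i
  inverse-increasing : ∀ {a b} → a F.< b → σ ⟨$⟩ˡ a F.< σ ⟨$⟩ˡ b
  inverse-increasing a<b =
    from (iso _ _) (subst₂ F._<_ (sym (P.inverseʳ σ)) (sym (P.inverseʳ σ)) a<b)
  σi≤i : σ ⟨$⟩ʳ i F.≤ i
  σi≤i = subst (σ ⟨$⟩ʳ i F.≤_) (P.inverseˡ σ)
           (increasing⇒inflationary (σ ⟨$⟩ˡ_) inverse-increasing (σ ⟨$⟩ʳ i))

-- Permutations whose ranks are equally ordered are equal: ρ′ ∘ ρ⁻¹ preserves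
-- and reflects order, hence is the identity.
ranks-sameOrder⇒≈ : {q : ℕ} (ρ ρ′ : Permutation′ q) →
                    SameOrder (ranks ρ) (ranks ρ′) → ∀ i → ρ′ ⟨$⟩ʳ i ≡ ρ ⟨$⟩ʳ i
ranks-sameOrder⇒≈ ρ ρ′ same i = begin
  ρ′ ⟨$⟩ʳ i                   ≡⟨ cong (ρ′ ⟨$⟩ʳ_) (P.inverseˡ ρ) ⟨
  τ ⟨$⟩ʳ (ρ ⟨$⟩ʳ i)           ≡⟨ orderIso⇒id τ τ-iso (ρ ⟨$⟩ʳ i) ⟩
  ρ ⟨$⟩ʳ i                    ∎
  where
  open ≡-Reasoning
  τ : Permutation′ _
  τ = P.flip ρ P.∘ₚ ρ′
  τ-iso : ∀ a b → (a F.< b) ⇔ (τ ⟨$⟩ʳ a F.< τ ⟨$⟩ʳ b)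
  τ-iso a b =
    ⇔.trans (subst₂ (λ x y → (a F.< b) ⇔ (x F.< y)) (sym (P.inverseʳ ρ)) (sym (P.inverseʳ ρ)) ⇔.refl)
      (⇔.trans (ranks-<⇔ ρ (ρ ⟨$⟩ˡ a) (ρ ⟨$⟩ˡ b))
        (⇔.trans (same _ _) (⇔.sym (ranks-<⇔ ρ′ (ρ ⟨$⟩ˡ a) (ρ ⟨$⟩ˡ b)))))

insert-at : {m n : ℕ} (i : Fin (suc m)) (j : Fin (suc n)) (π : P.Permutation m n) →
            P.insert i j π ⟨$⟩ʳ i ≡ j
insert-at i j π with i FP.≟ i
... | yes _   = refl
... | no i≢i = ⊥-elim (i≢i refl)

argmin : ∀ n (g : Fin (suc n) → ℤ) → Σ (Fin (suc n)) λ i₀ → ∀ x → g i₀ ℤ.≤ g x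
argmin zero    g = zero , λ { zero → ℤP.≤-refl }
argmin (suc n) g with argmin n (g ∘ suc)
... | j , min with g zero ℤP.≤? g (suc j)
...   | yes g0≤gj = zero , λ { zero → ℤP.≤-refl ; (suc x) → ℤP.≤-trans g0≤gj (min x) }
...   | no  g0≰gj = suc j , λ { zero → ℤP.<⇒≤ (ℤP.≰⇒> g0≰gj) ; (suc x) → min x }

data PunchView {n : ℕ} (i₀ : Fin (suc n)) : Fin (suc n) → Set where
  here  : PunchView i₀ i₀
  there : (a : Fin n) → PunchView i₀ (punchIn i₀ a)

punchView : {n : ℕ} (i₀ x : Fin (suc n)) → PunchView i₀ x
punchView i₀ x with i₀ FP.≟ x
... | yes refl = here
... | no i₀≢x  = subst (PunchView i₀) (FP.punchIn-punchOut i₀≢x) (there (punchOut i₀≢x))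

-- Every injective integer sequence is ordered like the ranks of some
-- permutation: send the minimum to rank 0 and rank the rest recursively.
rank : ∀ q (g : Fin q → ℤ) → Injective _≡_ _≡_ g →
       Σ (Permutation′ q) λ ρ → SameOrder g (ranks ρ)
rank zero    g _     = P.id , λ ()
rank (suc n) g g-inj = ρ , same
  where
  i₀ : Fin (suc n)
  i₀ = proj₁ (argmin n g)
  g-rest : Fin n → ℤ
  g-rest a = g (punchIn i₀ a)
  rest : Σ (Permutation′ n) λ ρ′ → SameOrder g-rest (ranks ρ′)
  rest = rank n g-rest (FP.punchIn-injective i₀ _ _ ∘ g-inj)
  ρ : Permutation′ (suc n)
  ρ = P.insert i₀ zero (proj₁ rest)
  ρ-i₀ : ranks ρ i₀ ≡ + 0
  ρ-i₀ = cong (+_ ∘ toℕ) (insert-at i₀ zero (proj₁ rest))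
  ρ-rest : ∀ a → ranks ρ (punchIn i₀ a) ≡ + suc (toℕ (proj₁ rest ⟨$⟩ʳ a))
  ρ-rest a = cong (+_ ∘ toℕ) (P.insert-punchIn i₀ zero (proj₁ rest) a)
  minimum : ∀ a → g i₀ ℤ.< g-rest a
  minimum a = ℤP.≤∧≢⇒< (proj₂ (argmin n g) _) (FP.punchInᵢ≢i i₀ a ∘ sym ∘ g-inj)
  same : SameOrder g (ranks ρ)
  same i j with punchView i₀ i | punchView i₀ j
  ... | here    | here    = ⇔-resp-< ρ-i₀ ρ-i₀
                              (mk⇔ (⊥-elim ∘ ℤP.<-irrefl refl) λ { (ℤ.+<+ ()) })
  ... | here    | there b = ⇔-resp-< ρ-i₀ (ρ-rest b)
                              (mk⇔ (λ _ → ℤ.+<+ (ℕ.s≤s ℕ.z≤n)) (λ _ → minimum b))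
  ... | there a | here    = ⇔-resp-< (ρ-rest a) ρ-i₀
                              (mk⇔ (λ ga<g₀ → ⊥-elim (ℤP.<-asym ga<g₀ (minimum a)))
                                   λ { (ℤ.+<+ ()) })
  ... | there a | there b = ⇔-resp-< (ρ-rest a) (ρ-rest b)
                              (⇔.trans (proj₂ rest a b)
                                (mk⇔ (ℤ.+<+ ∘ ℕ.s≤s ∘ ℤP.drop‿+<+) (ℤ.+<+ ∘ ℕ.s≤s⁻¹ ∘ ℤP.drop‿+<+)))

-- An enumeration of the symmetric group

-- The u-th permutation of Fin (suc n): write u in the mixed radix (suc n , n!)
-- as a pair (i , v); it sends 0 to i and acts on the rest like the v-th
-- permutation of Fin n.
enum : ∀ n → Fin (n !) → Permutation′ n
enum zero    _ = P.id
enum (suc n) u = P.insert zero (proj₁ (F.remQuot {suc n} (n !) u))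
                              (enum n (proj₂ (F.remQuot {suc n} (n !) u)))

enum-combine : ∀ n (i : Fin (suc n)) (v : Fin (n !)) →
               ∀ x → enum (suc n) (F.combine i v) ⟨$⟩ʳ x ≡ P.insert zero i (enum n v) ⟨$⟩ʳ x
enum-combine n i v x =
  cong (λ (p : Fin (suc n) × Fin (n !)) → P.insert zero (proj₁ p) (enum n (proj₂ p)) ⟨$⟩ʳ x)
       (FP.remQuot-combine {suc n} {n !} i v)

enum-injective : ∀ n (u v : Fin (n !)) → (∀ x → enum n u ⟨$⟩ʳ x ≡ enum n v ⟨$⟩ʳ x) → u ≡ v
enum-injective zero    zero zero _ = refl
enum-injective (suc n) u v same = begin
  u                                       ≡⟨ FP.combine-remQuot (n !) u ⟨
  F.combine (digit u) (rest u)            ≡⟨ cong₂ F.combine digit≡ rest≡ ⟩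
  F.combine (digit v) (rest v)            ≡⟨ FP.combine-remQuot (n !) v ⟩
  v                                       ∎
  where
  open ≡-Reasoning
  digit : Fin (suc n !) → Fin (suc n)
  digit w = proj₁ (F.remQuot {suc n} (n !) w)
  rest : Fin (suc n !) → Fin (n !)
  rest w = proj₂ (F.remQuot {suc n} (n !) w)
  digit≡ : digit u ≡ digit v
  digit≡ = trans (sym (insert-at zero (digit u) (enum n (rest u))))
                 (trans (same zero) (insert-at zero (digit v) (enum n (rest v))))
  rest≡ : rest u ≡ rest v
  rest≡ = enum-injective n (rest u) (rest v) λ x →
    FP.punchIn-injective (digit u) _ _ (begin
      punchIn (digit u) (enum n (rest u) ⟨$⟩ʳ x)  ≡⟨ P.insert-punchIn zero (digit u) (enum n (rest u)) x ⟨
      enum (suc n) u ⟨$⟩ʳ suc x                    ≡⟨ same (suc x) ⟩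
      enum (suc n) v ⟨$⟩ʳ suc x                    ≡⟨ P.insert-punchIn zero (digit v) (enum n (rest v)) x ⟩
      punchIn (digit v) (enum n (rest v) ⟨$⟩ʳ x)  ≡⟨ cong (λ d → punchIn d (enum n (rest v) ⟨$⟩ʳ x)) digit≡ ⟨
      punchIn (digit u) (enum n (rest v) ⟨$⟩ʳ x)  ∎)

enum-surjective : ∀ n (σ : Permutation′ n) →
                  Σ (Fin (n !)) λ u → ∀ x → enum n u ⟨$⟩ʳ x ≡ σ ⟨$⟩ʳ x
enum-surjective zero    σ = zero , λ ()
enum-surjective (suc n) σ = F.combine {suc n} (σ ⟨$⟩ʳ zero) v , λ x →
  trans (enum-combine n (σ ⟨$⟩ʳ zero) v x) (agrees x)
  where
  rest : Σ (Fin (n !)) λ v → ∀ x → enum n v ⟨$⟩ʳ x ≡ P.remove zero σ ⟨$⟩ʳ x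
  rest = enum-surjective n (P.remove zero σ)
  v : Fin (n !)
  v = proj₁ rest
  agrees : ∀ x → P.insert zero (σ ⟨$⟩ʳ zero) (enum n v) ⟨$⟩ʳ x ≡ σ ⟨$⟩ʳ x
  agrees zero    = insert-at zero (σ ⟨$⟩ʳ zero) (enum n v)
  agrees (suc x) = begin
    P.insert zero (σ ⟨$⟩ʳ zero) (enum n v) ⟨$⟩ʳ suc x  ≡⟨ P.insert-punchIn zero _ (enum n v) x ⟩
    punchIn (σ ⟨$⟩ʳ zero) (enum n v ⟨$⟩ʳ x)           ≡⟨ cong (punchIn _) (proj₂ rest x) ⟩
    punchIn (σ ⟨$⟩ʳ zero) (P.remove zero σ ⟨$⟩ʳ x)   ≡⟨ P.punchIn-permute σ zero x ⟨
    σ ⟨$⟩ʳ suc x                                      ∎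
    where open ≡-Reasoning

module ℚSolver = Data.Rational.Solver.+-*-Solver

ι≃ : ∀ z → ℚ.toℚᵘ (ι z) U.≃ mkℚᵘ z 0
ι≃ z = ℚP.toℚᵘ-fromℚᵘ (mkℚᵘ z 0)

ι-+ : ∀ x y → ι (x ℤ.+ y) ≡ ι x ℚ.+ ι y
ι-+ x y = ℚP.toℚᵘ-injective (UP.≃-trans (ι≃ _) (UP.≃-trans sum≃
  (UP.≃-sym (UP.≃-trans (ℚP.toℚᵘ-homo-+ (ι x) (ι y)) (UP.+-cong (ι≃ x) (ι≃ y))))))
  where
  eq : ∀ x y → (x ℤ.+ y) ℤ.* + 1 ≡ (x ℤ.* + 1 ℤ.+ y ℤ.* + 1) ℤ.* + 1
  eq = ℤSolver.solve-∀
  sum≃ : mkℚᵘ (x ℤ.+ y) 0 U.≃ mkℚᵘ x 0 U.+ mkℚᵘ y 0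
  sum≃ = *≡* (eq x y)

ι-* : ∀ x y → ι (x ℤ.* y) ≡ ι x ℚ.* ι y
ι-* x y = ℚP.toℚᵘ-injective (UP.≃-trans (ι≃ _)
  (UP.≃-sym (UP.≃-trans (ℚP.toℚᵘ-homo-* (ι x) (ι y)) (UP.*-cong (ι≃ x) (ι≃ y)))))

ι-denominator : ∀ x → ι (+ ℚ.↧ₙ x) ℚ.* x ≡ ι (ℚ.↥ x)
ι-denominator x@(mkℚ n d _) = ℚP.toℚᵘ-injective
  (UP.≃-trans (ℚP.toℚᵘ-homo-* (ι (+ suc d)) x)
    (UP.≃-trans (UP.*-congʳ (ι≃ (+ suc d))) (UP.≃-sym (UP.≃-trans (ι≃ n) (*≡* (eq n d))))))
  where
  eq : ∀ n d → n ℤ.* + suc (d ℕ.+ 0) ≡ (+ suc d ℤ.* n) ℤ.* + 1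
  eq n d rewrite ℕP.+-identityʳ d = sym (trans (ℤP.*-identityʳ _) (ℤP.*-comm (+ suc d) n))

ι-clear : ∀ x p → ι (+ p ℤ.* ℚ.↥ x) ≡ ι (+ (p ℕ.* ℚ.↧ₙ x)) ℚ.* x
ι-clear x p = begin
  ι (+ p ℤ.* ℚ.↥ x)                  ≡⟨ ι-* (+ p) (ℚ.↥ x) ⟩
  ι (+ p) ℚ.* ι (ℚ.↥ x)              ≡⟨ cong (ι (+ p) ℚ.*_) (ι-denominator x) ⟨
  ι (+ p) ℚ.* (ι (+ ℚ.↧ₙ x) ℚ.* x)   ≡⟨ ℚP.*-assoc (ι (+ p)) _ x ⟨
  (ι (+ p) ℚ.* ι (+ ℚ.↧ₙ x)) ℚ.* x   ≡⟨ cong (ℚ._* x) (ι-* (+ p) (+ ℚ.↧ₙ x)) ⟨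
  ι (+ p ℤ.* + ℚ.↧ₙ x) ℚ.* x         ≡⟨ cong (λ z → ι z ℚ.* x) (ℤP.pos-* p (ℚ.↧ₙ x)) ⟨
  ι (+ (p ℕ.* ℚ.↧ₙ x)) ℚ.* x         ∎
  where open ≡-Reasoning

archimedean : ∀ s ε → 0ℚ ℚ.< ε → Σ ℕ λ N → ∀ t → N ℕ.≤ t → s ℚ.< ι (+ t) ℚ.* ε
archimedean _ (mkℚ +0 _ _)       (ℚ.*<* (ℤ.+<+ ()))
archimedean _ (mkℚ -[1+ _ ] _ _) (ℚ.*<* ())
archimedean (mkℚ sn sd _) ε@(mkℚ +[1+ e ] ed _) _ = N , λ t N≤t →
  ℚP.toℚᵘ-cancel-< (UP.<-respʳ-≃ (UP.≃-sym (tε≃ t)) (*<* (cross t N≤t)))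
  where
  D N : ℕ
  D = suc (ed ℕ.+ 0)
  N = suc (ℤ.∣ sn ∣ ℕ.* D)
  tε≃ : ∀ t → ℚ.toℚᵘ (ι (+ t) ℚ.* ε) U.≃ mkℚᵘ (+ t) 0 U.* mkℚᵘ +[1+ e ] ed
  tε≃ t = UP.≃-trans (ℚP.toℚᵘ-homo-* (ι (+ t)) ε) (UP.*-congʳ (ι≃ (+ t)))
  -- the cross-multiplied form of s < t·ε
  cross : ∀ t → N ℕ.≤ t → sn ℤ.* + D ℤ.< (+ t ℤ.* +[1+ e ]) ℤ.* + suc sd
  cross t N≤t = subst (sn ℤ.* + D ℤ.<_) rhs (below sn N≤t)
    where
    rhs : + (t ℕ.* suc e ℕ.* suc sd) ≡ (+ t ℤ.* +[1+ e ]) ℤ.* + suc sd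
    rhs = trans (ℤP.pos-* (t ℕ.* suc e) (suc sd)) (cong (ℤ._* + suc sd) (ℤP.pos-* t (suc e)))
    t≤ : t ℕ.≤ t ℕ.* suc e ℕ.* suc sd
    t≤ = ℕP.≤-trans (ℕP.m≤m*n t (suc e)) (ℕP.m≤m*n (t ℕ.* suc e) (suc sd))
    below : ∀ x → suc (ℤ.∣ x ∣ ℕ.* D) ℕ.≤ t → x ℤ.* + D ℤ.< + (t ℕ.* suc e ℕ.* suc sd)
    below (+ k)    lt = subst (ℤ._< _) (ℤP.pos-* k D) (ℤ.+<+ (ℕP.<-≤-trans lt t≤))
    below -[1+ k ] _  = ℤ.-<+

finiteBound : ∀ n (f : Fin n → ℕ) → Σ ℕ λ N → ∀ l → f l ℕ.≤ N
finiteBound zero    f = 0 , λ ()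
finiteBound (suc n) f = f zero ℕ.⊔ N , λ
  { zero    → ℕP.m≤m⊔n (f zero) N
  ; (suc l) → ℕP.≤-trans (proj₂ (finiteBound n (f ∘ suc)) l) (ℕP.m≤n⊔m (f zero) N) }
  where N = proj₁ (finiteBound n (f ∘ suc))

-- Translating finitely many lattice points into a dilated interior

HasInteriorPoint : Polygon → Set
HasInteriorPoint B = ∃ λ x → ∃ λ y → InB° B x y

_+v_ : Vec2 → Vec2 → Vec2
(a , b) +v (c , d) = (a ℤ.+ c , b ℤ.+ d)

form : (B : Polygon) → Fin (n B) → ℚ → ℚ → ℚ
form B l x y = a B l ℚ.* x ℚ.+ b B l ℚ.* y

translated-constraint : (B : Polygon) (l : Fin (n B)) (t : ℕ) (x₀ y₀ : ℚ) (C w : Vec2) →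
  ι (proj₁ C) ≡ ι (+ t) ℚ.* x₀ → ι (proj₂ C) ≡ ι (+ t) ℚ.* y₀ →
  form B l (ι (proj₁ w)) (ι (proj₂ w)) ℚ.< ι (+ t) ℚ.* (c B l ℚ.- form B l x₀ y₀) →
  form B l (ι (proj₁ (C +v w))) (ι (proj₂ (C +v w))) ℚ.< ι (+ t) ℚ.* c B l
translated-constraint B l t x₀ y₀ (Cx , Cy) (X , Y) Cx≡ Cy≡ below = begin-strict
  a B l ℚ.* ι (Cx ℤ.+ X) ℚ.+ b B l ℚ.* ι (Cy ℤ.+ Y)
    ≡⟨ cong₂ (λ u v → a B l ℚ.* u ℚ.+ b B l ℚ.* v)
         (trans (ι-+ Cx X) (cong (ℚ._+ ι X) Cx≡)) (trans (ι-+ Cy Y) (cong (ℚ._+ ι Y) Cy≡)) ⟩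
  a B l ℚ.* (T ℚ.* x₀ ℚ.+ ι X) ℚ.+ b B l ℚ.* (T ℚ.* y₀ ℚ.+ ι Y)
    ≡⟨ solve 7 (λ A B′ T′ x y X′ Y′ →
         A :* (T′ :* x :+ X′) :+ B′ :* (T′ :* y :+ Y′)
           := T′ :* (A :* x :+ B′ :* y) :+ (A :* X′ :+ B′ :* Y′))
         refl (a B l) (b B l) T x₀ y₀ (ι X) (ι Y) ⟩
  T ℚ.* form B l x₀ y₀ ℚ.+ form B l (ι X) (ι Y)
    <⟨ ℚP.+-monoʳ-< (T ℚ.* form B l x₀ y₀) below ⟩
  T ℚ.* form B l x₀ y₀ ℚ.+ T ℚ.* (c B l ℚ.- form B l x₀ y₀)
    ≡⟨ solve 3 (λ T′ s c′ → T′ :* s :+ T′ :* (c′ :- s) := T′ :* c′) refl T (form B l x₀ y₀) (c B l) ⟩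
  T ℚ.* c B l ∎
  where
  open ℚP.≤-Reasoning
  open ℚSolver
  T : ℚ
  T = ι (+ t)

-- If B° contains a rational point p, then for every finite family w of lattice
-- points some translate C + w lies in t B° (t ≥ 1): take t a large multiple of
-- the denominators of p and C = t p, so that the slack t·(c_l − ⟨a_l , p⟩) of
-- each constraint exceeds the values ⟨a_l , w_i⟩ (Archimedes).
translateInto : (B : Polygon) → HasInteriorPoint B → {q : ℕ} (w : Fin q → Vec2) →
                Σ ℕ λ t → Σ Vec2 λ C → (1 ℕ.≤ t) × (∀ i → InTB° B t (C +v w i))
translateInto B (x₀@(mkℚ nx dx _) , y₀@(mkℚ ny dy _) , interior) {q} w =
  t , (Cx , Cy) , 1≤t , λ i l →
    translated-constraint B l t x₀ y₀ (Cx , Cy) (w i) Cx≡ Cy≡ (proj₂ (eventually l i) t (large l i))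
  where
  slack-pos : ∀ l → 0ℚ ℚ.< c B l ℚ.- form B l x₀ y₀
  slack-pos l = subst (ℚ._< c B l ℚ.- form B l x₀ y₀) (ℚP.+-inverseʳ (form B l x₀ y₀))
                      (ℚP.+-monoˡ-< (ℚ.- form B l x₀ y₀) (interior l))
  eventually : ∀ l i → Σ ℕ λ N → ∀ t → N ℕ.≤ t →
               form B l (ι (proj₁ (w i))) (ι (proj₂ (w i))) ℚ.< ι (+ t) ℚ.* (c B l ℚ.- form B l x₀ y₀)
  eventually l i = archimedean _ _ (slack-pos l)
  bound : ∀ l → Σ ℕ λ N → ∀ i → proj₁ (eventually l i) ℕ.≤ N
  bound l = finiteBound q (λ i → proj₁ (eventually l i))
  K t : ℕ
  K = suc (proj₁ (finiteBound (n B) (λ l → proj₁ (bound l))))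
  t = K ℕ.* (suc dx ℕ.* suc dy)
  Cx Cy : ℤ
  Cx = + (K ℕ.* suc dy) ℤ.* nx
  Cy = + (K ℕ.* suc dx) ℤ.* ny
  1≤t : 1 ℕ.≤ t
  1≤t = ℕP.≤-trans (ℕ.s≤s ℕ.z≤n) (ℕP.m≤m*n K (suc dx ℕ.* suc dy))
  large : ∀ l i → proj₁ (eventually l i) ℕ.≤ t
  large l i = ℕP.≤-trans (proj₂ (bound l) i)
    (ℕP.≤-trans (proj₂ (finiteBound (n B) (λ l → proj₁ (bound l))) l)
      (ℕP.≤-trans (ℕP.n≤1+n _) (ℕP.m≤m*n K _)))
  Cx≡ : ι Cx ≡ ι (+ t) ℚ.* x₀
  Cx≡ = trans (ι-clear x₀ (K ℕ.* suc dy)) (cong (λ k → ι (+ k) ℚ.* x₀) (reorder K dx dy))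
    where
    reorder : ∀ K dx dy → K ℕ.* suc dy ℕ.* suc dx ≡ K ℕ.* (suc dx ℕ.* suc dy)
    reorder = ℕSolver.solve-∀
  Cy≡ : ι Cy ≡ ι (+ t) ℚ.* y₀
  Cy≡ = trans (ι-clear y₀ (K ℕ.* suc dx)) (cong (λ k → ι (+ k) ℚ.* y₀) (ℕP.*-assoc K (suc dx) (suc dy)))

·-sub : ∀ (u v p : Vec2) → (v -v u) · p ≡ v · p ℤ.- u · p
·-sub (u₁ , u₂) (v₁ , v₂) (p₁ , p₂) = solve u₁ u₂ v₁ v₂ p₁ p₂
  where
  solve : ∀ u₁ u₂ v₁ v₂ p₁ p₂ → (v₁ ℤ.- u₁) ℤ.* p₁ ℤ.+ (v₂ ℤ.- u₂) ℤ.* p₂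
                              ≡ (v₁ ℤ.* p₁ ℤ.+ v₂ ℤ.* p₂) ℤ.- (u₁ ℤ.* p₁ ℤ.+ u₂ ℤ.* p₂)
  solve = ℤSolver.solve-∀

+v-sub : ∀ (C u v : Vec2) → (C +v v) -v (C +v u) ≡ v -v u
+v-sub (c₁ , c₂) (u₁ , u₂) (v₁ , v₂) = cong₂ _,_ (solve c₁ u₁ v₁) (solve c₂ u₂ v₂)
  where
  solve : ∀ c u v → (c ℤ.+ v) ℤ.- (c ℤ.+ u) ≡ v ℤ.- u
  solve = ℤSolver.solve-∀

0<b-a⇔a<b : ∀ a b → (0ℤ ℤ.< b ℤ.- a) ⇔ (a ℤ.< b)
0<b-a⇔a<b a b = mk⇔
  (λ 0<b-a → subst₂ ℤ._<_ (ℤP.+-identityˡ a) (b-a+a b a) (ℤP.+-monoˡ-< a 0<b-a))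
  (λ a<b → subst (ℤ._< b ℤ.- a) (ℤP.+-inverseʳ a) (ℤP.+-monoˡ-< (ℤ.- a) a<b))
  where
  b-a+a : ∀ b a → (b ℤ.- a) ℤ.+ a ≡ b
  b-a+a = ℤSolver.solve-∀

typeOf-order : ∀ k (m : Fin k → Vec2) q (z : Config q) i r j →
               typeOf k m q z i r j ≡ order (λ i → z i · perp (m r)) i j
typeOf-order k m q z i r j =
  isYes-⇔ (0ℤ ℤP.<? (z j -v z i) · p) (z i · p ℤP.<? z j · p)
    (subst (λ x → (0ℤ ℤ.< x) ⇔ (z i · p ℤ.< z j · p)) (sym (·-sub (z i) (z j) p))
           (0<b-a⇔a<b (z i · p) (z j · p)))
  where p = perp (m r)

typeOf-translate : ∀ k (m : Fin k → Vec2) q (z : Config q) (C : Vec2) i r j →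
                   typeOf k m q (λ i → C +v z i) i r j ≡ typeOf k m q z i r j
typeOf-translate k m q z C i r j =
  cong (λ v → ⌊ 0ℤ ℤP.<? v · perp (m r) ⌋) (+v-sub C (z i) (z j))

nonattacking⇒injective : ∀ k (m : Fin k → Vec2) q (z : Config q) → Nonattacking k m q z →
                         ∀ r → Injective _≡_ _≡_ (λ i → z i · perp (m r))
nonattacking⇒injective k m q z na r {i} {j} zi≡zj with i FP.≟ j
... | yes i≡j = i≡j
... | no  i≢j = ⊥-elim (na i j i≢j r (begin
  (z j -v z i) · perp (m r)                 ≡⟨ ·-sub (z i) (z j) (perp (m r)) ⟩
  z j · perp (m r) ℤ.- z i · perp (m r)     ≡⟨ cong (ℤ._- z i · perp (m r)) zi≡zj ⟨
  z i · perp (m r) ℤ.- z i · perp (m r)     ≡⟨ ℤP.+-inverseʳ (z i · perp (m r)) ⟩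
  0ℤ                                        ∎))
  where open ≡-Reasoning

injective⇒nonattacking : ∀ k (m : Fin k → Vec2) q (z : Config q) →
                         (∀ r → Injective _≡_ _≡_ (λ i → z i · perp (m r))) → Nonattacking k m q z
injective⇒nonattacking k m q z inj i j i≢j r diff≡0 =
  i≢j (sym (inj r (ℤP.i-j≡0⇒i≡j _ _ (trans (sym (·-sub (z i) (z j) (perp (m r)))) diff≡0))))

nonattacking-translate : ∀ k (m : Fin k → Vec2) q (z : Config q) (C : Vec2) →
                         Nonattacking k m q z → Nonattacking k m q (λ i → C +v z i)
nonattacking-translate k m q z C na i j i≢j r =
  subst (λ v → v · perp (m r) ≢ 0ℤ) (sym (+v-sub C (z i) (z j))) (na i j i≢j r)

-- Labelled types are tuples of rank permutations

permType : {k q : ℕ} → (Fin k → Permutation′ q) → LType k q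
permType π i r j = order (ranks (π r)) i j

-- Every labelled type is of this form, with π_r ranking the values z · m_r^⊥.
labelledType⇒permType : ∀ k (m : Fin k → Vec2) B q (T : LType k q) → IsLabelledType k m B q T →
                        Σ (Fin k → Permutation′ q) λ π → ∀ i r j → T i r j ≡ permType π i r j
labelledType⇒permType k m B q T (_ , z , _ , _ , na , T≡) = π , λ i r j →
  trans (T≡ i r j) (trans (typeOf-order k m q z i r j) (sameOrder⇒order≡ (proj₂ (ranking r)) i j))
  where
  ranking : ∀ r → Σ (Permutation′ q) λ ρ → SameOrder (λ i → z i · perp (m r)) (ranks ρ)
  ranking r = rank q (λ i → z i · perp (m r)) (nonattacking⇒injective k m q z na r)
  π : Fin k → Permutation′ q
  π r = proj₁ (ranking r)

permType-orbit : ∀ {k q} (π ρ : Fin k → Permutation′ q) (σ : Permutation′ q) →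
                 (∀ r i → ρ r ⟨$⟩ʳ (σ ⟨$⟩ʳ i) ≡ π r ⟨$⟩ʳ i) →
                 (T : LType k q) → (∀ i r j → T i r j ≡ permType ρ i r j) → SameOrbit k q (permType π) T
permType-orbit π ρ σ ρσ≡π T T≡ = σ , λ i r j →
  trans (T≡ _ r _) (cong₂ (λ x y → ⌊ + toℕ x ℤP.<? + toℕ y ⌋) (ρσ≡π r i) (ρσ≡π r j))

orbit⇒precompose : ∀ {k q} (π ρ : Fin k → Permutation′ q) → SameOrbit k q (permType π) (permType ρ) →
                   Σ (Permutation′ q) λ σ → ∀ r i → ρ r ⟨$⟩ʳ (σ ⟨$⟩ʳ i) ≡ π r ⟨$⟩ʳ i
orbit⇒precompose π ρ (σ , orbit) = σ , λ r →
  ranks-sameOrder⇒≈ (π r) (σ P.∘ₚ ρ r) (order≡⇒sameOrder (λ i j → sym (orbit i r j)))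

-- Realising tuples of permutations

-- If lattice vectors w have r-th values w_i · m_r^⊥ proportional (with a
-- positive factor) to the ranks of π_r, then permType π is a labelled type:
-- a translate of w is a nonattacking configuration in some t B°.
realise : ∀ k (m : Fin k → Vec2) (B : Polygon) → HasInteriorPoint B →
          ∀ q (π : Fin k → Permutation′ q) (w : Fin q → Vec2) (s : ℕ) →
          (∀ r i → w i · perp (m r) ≡ ranks (π r) i ℤ.* +[1+ s ]) →
          IsLabelledType k m B q (permType π)
realise k m B interior q π w s values with translateInto B interior w
... | t , C , 1≤t , inside =
  t , z , 1≤t , inside , nonattacking-translate k m q w C w-nonattacking , types
  where
  z : Config q
  z i = C +v w i
  w-order : ∀ r → SameOrder (λ i → w i · perp (m r)) (ranks (π r))
  w-order r i j = ⇔.sym (⇔-resp-< (values r i) (values r j)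
                    (⇔.sym (sameOrder-scale (ranks (π r)) s i j)))
  w-nonattacking : Nonattacking k m q w
  w-nonattacking = injective⇒nonattacking k m q w λ r →
    sameOrder-injective (w-order r) (ranks-injective (π r))
  types : ∀ i r j → permType π i r j ≡ typeOf k m q z i r j
  types i r j = sym (trans (typeOf-translate k m q w C i r j)
                      (trans (typeOf-order k m q w i r j) (sameOrder⇒order≡ (w-order r) i j)))

_*v_ : ℤ → Vec2 → Vec2
x *v (a , b) = (x ℤ.* a , x ℤ.* b)

*v-· : ∀ x (u p : Vec2) → (x *v u) · p ≡ x ℤ.* (u · p)
*v-· x (u₁ , u₂) (p₁ , p₂) = linear x u₁ u₂ p₁ p₂
  where
  linear : ∀ x u₁ u₂ p₁ p₂ → x ℤ.* u₁ ℤ.* p₁ ℤ.+ x ℤ.* u₂ ℤ.* p₂ ≡ x ℤ.* (u₁ ℤ.* p₁ ℤ.+ u₂ ℤ.* p₂)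
  linear = ℤSolver.solve-∀

-- For a single move u ≠ 0 one uses multiples of u^⊥, and ‖u^⊥‖² > 0.
perp-norm-positive : ∀ (u : Vec2) → u ≢ (0ℤ , 0ℤ) → Σ ℕ λ s → perp u · perp u ≡ +[1+ s ]
perp-norm-positive (+0 , +0) u≢0 = ⊥-elim (u≢0 refl)
perp-norm-positive (+0 , +[1+ _ ]) _ = _ , refl
perp-norm-positive (+0 , -[1+ _ ]) _ = _ , refl
perp-norm-positive (+[1+ _ ] , +0) _ = _ , refl
perp-norm-positive (+[1+ _ ] , +[1+ _ ]) _ = _ , refl
perp-norm-positive (+[1+ _ ] , -[1+ _ ]) _ = _ , refl
perp-norm-positive (-[1+ _ ] , +0) _ = _ , refl
perp-norm-positive (-[1+ _ ] , +[1+ _ ]) _ = _ , refl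
perp-norm-positive (-[1+ _ ] , -[1+ _ ]) _ = _ , refl

square-positive : ∀ x → x ≢ 0ℤ → Σ ℕ λ s → x ℤ.* x ≡ +[1+ s ]
square-positive +0 x≢0 = ⊥-elim (x≢0 refl)
square-positive +[1+ _ ] _ = _ , refl
square-positive -[1+ _ ] _ = _ , refl

det : Vec2 → Vec2 → ℤ
det u v = proj₁ u ℤ.* proj₂ v ℤ.- proj₂ u ℤ.* proj₁ v

-- For two moves u, v with Δ = det u v, the vector Δ(b u − a v) has values
-- a Δ² against u^⊥ and b Δ² against v^⊥.
combo : Vec2 → Vec2 → ℤ → ℤ → Vec2
combo u v a b = det u v *v ((b *v u) -v (a *v v))

combo-perpˡ : ∀ u v a b → combo u v a b · perp u ≡ a ℤ.* (det u v ℤ.* det u v)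
combo-perpˡ (c , d) (c′ , d′) a b = identity c d c′ d′ a b
  where
  identity : ∀ c d c′ d′ a b → let Δ = c ℤ.* d′ ℤ.- d ℤ.* c′ in
    Δ ℤ.* (b ℤ.* c ℤ.- a ℤ.* c′) ℤ.* d ℤ.+ Δ ℤ.* (b ℤ.* d ℤ.- a ℤ.* d′) ℤ.* (ℤ.- c) ≡ a ℤ.* (Δ ℤ.* Δ)
  identity = ℤSolver.solve-∀

combo-perpʳ : ∀ u v a b → combo u v a b · perp v ≡ b ℤ.* (det u v ℤ.* det u v)
combo-perpʳ (c , d) (c′ , d′) a b = identity c d c′ d′ a b
  where
  identity : ∀ c d c′ d′ a b → let Δ = c ℤ.* d′ ℤ.- d ℤ.* c′ in
    Δ ℤ.* (b ℤ.* c ℤ.- a ℤ.* c′) ℤ.* d′ ℤ.+ Δ ℤ.* (b ℤ.* d ℤ.- a ℤ.* d′) ℤ.* (ℤ.- c′) ≡ b ℤ.* (Δ ℤ.* Δ)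
  identity = ℤSolver.solve-∀

-- With one move, every labelled type is permType of a single permutation,
-- and relabelling by its inverse reaches permType id: one orbit.
oneMove : ∀ (m : Fin 1 → Vec2) → ValidMoves 1 m → (B : Polygon) →
          HasInteriorPoint B → ∀ q → NumUnlabelledTypes 1 m B q 1
oneMove m (m≢0 , _) B interior q =
  (λ _ → permType identity) , (λ _ → realised) , (λ { zero zero _ → refl }) , covers
  where
  identity : Fin 1 → Permutation′ q
  identity _ = P.id
  norm : Σ ℕ λ s → perp (m zero) · perp (m zero) ≡ +[1+ s ]
  norm = perp-norm-positive (m zero) (m≢0 zero)
  realised : IsLabelledType 1 m B q (permType identity)
  realised = realise 1 m B interior q identity (λ i → ranks P.id i *v perp (m zero)) (proj₁ norm)
    λ { zero i → trans (*v-· (ranks P.id i) (perp (m zero)) (perp (m zero)))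
                       (cong (ranks P.id i ℤ.*_) (proj₂ norm)) }
  covers : ∀ T → IsLabelledType 1 m B q T → ∃ λ u → SameOrbit 1 q (permType identity) T
  covers T T-type = zero ,
    permType-orbit identity ρ (P.flip (ρ zero)) (λ { zero i → P.inverseʳ (ρ zero) }) T (proj₂ ranked)
    where
    ranked : Σ (Fin 1 → Permutation′ q) λ ρ → ∀ i r j → T i r j ≡ permType ρ i r j
    ranked = labelledType⇒permType 1 m B q T T-type
    ρ : Fin 1 → Permutation′ q
    ρ = proj₁ ranked

-- With two moves, every labelled type is in the orbit of exactly one
-- permType (id , enum q u): relabel by π₀⁻¹, then π₁ ∘ π₀⁻¹ is determined.
twoMoves : ∀ (m : Fin 2 → Vec2) → ValidMoves 2 m → (B : Polygon) →
           HasInteriorPoint B → ∀ q → NumUnlabelledTypes 2 m B q (q !)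
twoMoves m (_ , _ , nonparallel) B interior q =
  (λ u → permType (pair u)) , realised , distinct , covers
  where
  pair : Fin (q !) → Fin 2 → Permutation′ q
  pair u zero       = P.id
  pair u (suc zero) = enum q u
  Δ² : Σ ℕ λ s → det (m zero) (m (suc zero)) ℤ.* det (m zero) (m (suc zero)) ≡ +[1+ s ]
  Δ² = square-positive (det (m zero) (m (suc zero))) (nonparallel zero (suc zero) (λ ()))
  realised : ∀ u → IsLabelledType 2 m B q (permType (pair u))
  realised u = realise 2 m B interior q (pair u) w (proj₁ Δ²) λ
    { zero i       → trans (combo-perpˡ (m zero) (m (suc zero)) (rank₀ i) (rank₁ i))
                           (cong (rank₀ i ℤ.*_) (proj₂ Δ²))
    ; (suc zero) i → trans (combo-perpʳ (m zero) (m (suc zero)) (rank₀ i) (rank₁ i))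
                           (cong (rank₁ i ℤ.*_) (proj₂ Δ²)) }
    where
    rank₀ rank₁ : Fin q → ℤ
    rank₀ = ranks (pair u zero)
    rank₁ = ranks (pair u (suc zero))
    w : Fin q → Vec2
    w i = combo (m zero) (m (suc zero)) (rank₀ i) (rank₁ i)
  distinct : ∀ u v → SameOrbit 2 q (permType (pair u)) (permType (pair v)) → u ≡ v
  distinct u v orbit = enum-injective q u v λ x →
    sym (trans (cong (enum q v ⟨$⟩ʳ_) (sym (σ-fixes zero x))) (σ-fixes (suc zero) x))
    where
    σ-fixes : ∀ r i → pair v r ⟨$⟩ʳ (proj₁ (orbit⇒precompose (pair u) (pair v) orbit) ⟨$⟩ʳ i)
                      ≡ pair u r ⟨$⟩ʳ i
    σ-fixes = proj₂ (orbit⇒precompose (pair u) (pair v) orbit)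
  covers : ∀ T → IsLabelledType 2 m B q T → ∃ λ u → SameOrbit 2 q (permType (pair u)) T
  covers T T-type = u , permType-orbit (pair u) ρ σ agree T (proj₂ ranked)
    where
    ranked : Σ (Fin 2 → Permutation′ q) λ ρ → ∀ i r j → T i r j ≡ permType ρ i r j
    ranked = labelledType⇒permType 2 m B q T T-type
    ρ : Fin 2 → Permutation′ q
    ρ = proj₁ ranked
    σ : Permutation′ q
    σ = P.flip (ρ zero)
    enumerated : Σ (Fin (q !)) λ u → ∀ x → enum q u ⟨$⟩ʳ x ≡ (σ P.∘ₚ ρ (suc zero)) ⟨$⟩ʳ x
    enumerated = enum-surjective q (σ P.∘ₚ ρ (suc zero))
    u : Fin (q !)
    u = proj₁ enumerated
    agree : ∀ r i → ρ r ⟨$⟩ʳ (σ ⟨$⟩ʳ i) ≡ pair u r ⟨$⟩ʳ i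
    agree zero       i = P.inverseʳ (ρ zero)
    agree (suc zero) i = sym (proj₂ enumerated i)

theorem5p8 : (k : ℕ) (m : Fin k → Vec2) → ValidMoves k m →
    (B : Polygon) → ValidPolygon B →
    (q : ℕ) → 1 ≤ q →
    (k ≡ 1 → NumUnlabelledTypes k m B q 1)
    × (k ≡ 2 → NumUnlabelledTypes k m B q (q !))
theorem5p8 k m valid B (_ , interior , _) q _ =
  (λ { refl → oneMove m valid B interior q }) , (λ { refl → twoMoves m valid B interior q })
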